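{- Let $(G,A,O)$ be a higher-order game and let $\mathcal{M}^C=(\mathcal{D}^C,\mathcal{I}^C)$ be the concrete model of the determinized scheme $\mathrm{det}(G)$. Then for every terminal $s$ of $\mathrm{det}(G)$ of non-ground kind, $\mathcal{I}^C(s)$ is $\sqcap$-continuous (as a curried function, in each argument, so that $\mathcal{I}^C(s)\in\mathcal{D}^C_\kappa$ where $\kappa$ is the kind of $s$).
   Context: Kinds: $\kappa ::= o\mid\kappa_1\to\kappa_2$. A scheme $G=(V,N,T,R,S)$ has kinded variables $V$, non-terminals $N$ with initial $S$, terminals $T$, and rules $F=\lambda x_1\ldots\lambda x_n.e$ ($e$ a $\lambda$-free term of kind $o$ over $T\cup N\cup\{x_1,\dots,x_n\}$). $G$ is word-generating if its terminals are one symbol $\$:o$ and others of kind $o\to o$; a term $a_1(a_2(\cdots(a_k\,\$)))$ is identified with the word $a_1\cdots a_k$. The determinization $\mathrm{det}(G)$: for each $F\in N$ with rules $F=\lambda x_1\ldots\lambda x_k.e_1,\dots,F=\lambda x_1\ldots\lambda x_k.e_\ell$, add a terminal $op_F:o\to\cdots\to o$ of arity $\ell$ and replace these rules by the single rule $F=\lambda x_1\ldots\lambda x_k.\,op_F\,e_1\cdots e_\ell$. A higher-order game is $(G,A,O)$ with $G$ a word-generating scheme, $A$ an NFA over the alphabet $\Sigma$ of terminals of kind $o\to o$, and $O:N\to\{\exists,\forall\}$. For a cppo (partial order with top in which descending chains have meets), $\sqcap$-continuity means preserving meets of descending chains; function domains $\mathcal{D}_{\kappa_1\to\kappa_2}$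 are the $\sqcap$-continuous functions ordered pointwise. Concrete model: positive Boolean formulas $\mathbb{B}(P)$ over propositions $P$ contain $\mathit{true}$, each $p\in P$, and are closed under $\wedge,\vee$. $\mathcal{D}^C_o$ is the set of non-empty (possibly infinite) sets of formulas in $\mathbb{B}(\Sigma^*)$, taken modulo equivalence: an assignment $L\subseteq\Sigma^*$ (making exactly the words in $L$ true) satisfies a set if it satisfies every element; $\Phi_1\Rightarrow\Phi_2$ if every assignment satisfying $\Phi_1$ satisfies $\Phi_2$, and $\Leftrightarrow$ is mutual implication. The order is $\Rightarrow$, top is $\{\mathit{true}\}$, meet is union, and $\Phi_1\vee\Phi_2=\{\varphi_1\vee\varphi_2:\varphi_i\in\Phi_i\}$. Interpretation: $\mathcal{I}^C(\$)=\{\varepsilon\}$; $\mathcal{I}^C(a)$ prepends $a$ to every word occurring in every formula (distributing over $\wedge,\vee$, with $\mathit{true}\mapsto\mathit{true}$), applied elementwise to sets; $\mathcal{I}^C(op_F)$ is the $\ell$-ary conjunction (union) if $O(F)=\forall$ and the $\ell$-ary disjunction if $O(F)=\exists$. -}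

module Defs where

open import Data.Nat using (ℕ; zero; suc)
open import Data.Fin using (Fin)
open import Data.Bool using (Bool)
open import Data.List using (List; []; _∷_; length)
open import Data.List.Membership.Propositional using (_∈_)
open import Data.Product using (Σ; ∃; _×_; _,_; proj₁; proj₂)
open import Data.Sum using (_⊎_)
open import Data.Unit using (⊤)
open import Data.Empty using (⊥; ⊥-elim)
open import Function using (_∘_)
open import Relation.Binary.PropositionalEquality using (_≡_; _≢_; refl)

infixr 5 _⇒_
data Kind : Set where
  o   : Kind
  _⇒_ : Kind → Kind → Kind

args : Kind → List Kind
args o         = []
args (κ₁ ⇒ κ₂) = κ₁ ∷ args κ₂

foKind : ℕ → Kind
foKind zero    = o
foKind (suc ℓ) = o ⇒ foKind ℓ

-- Alphabet Σ = Fin m (terminals of kind o → o, plus the terminal $ : o),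
-- non-terminals N = Fin n with kinds kindN.  The λ-bound variables
-- x₁ … xₖ of a rule for F are represented by de Bruijn positions in the
-- context  args (kindN F)  (so x_i has the i-th argument kind of F).

data Term (m n : ℕ) (kindN : Fin n → Kind) (Γ : List Kind) : Kind → Set where
  var    : ∀ {κ} → κ ∈ Γ → Term m n kindN Γ κ
  nt     : (F : Fin n) → Term m n kindN Γ (kindN F)
  dollar : Term m n kindN Γ o
  letter : Fin m → Term m n kindN Γ (o ⇒ o)
  app    : ∀ {κ₁ κ₂} → Term m n kindN Γ (κ₁ ⇒ κ₂) → Term m n kindN Γ κ₁
         → Term m n kindN Γ κ₂

record Scheme : Set where
  field
    m      : ℕ
    n      : ℕ
    kindN  : Fin n → Kind
    S      : Fin n
    S-kind : kindN S ≡ o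
    rules  : (F : Fin n) → List (Term m n kindN (args (kindN F)) o)

record NFA (m : ℕ) : Set where
  field
    Q       : ℕ
    initial : Fin Q → Bool
    final   : Fin Q → Bool
    δ       : Fin Q → Fin m → Fin Q → Bool

data Player : Set where
  ∃p ∀p : Player

record Game : Set where
  field
    G : Scheme
    A : NFA (Scheme.m G)
    O : Fin (Scheme.n G) → Player

data DetTerminal (G : Scheme) : Set where
  $      : DetTerminal G
  letter : Fin (Scheme.m G) → DetTerminal G
  op     : Fin (Scheme.n G) → DetTerminal G

kindT : {G : Scheme} → DetTerminal G → Kind
kindT $          = o
kindT (letter a) = o ⇒ o
kindT {G} (op F) = foKind (length (Scheme.rules G F))

module Concrete (m : ℕ) where

  Word : Set
  Word = List (Fin m)

  data Formula : Set where
    true : Formula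
    ⟨_⟩  : Word → Formula
    _∧_  : Formula → Formula → Formula
    _∨_  : Formula → Formula → Formula

  Sat : (Word → Set) → Formula → Set
  Sat L true      = ⊤
  Sat L ⟨ w ⟩     = L w
  Sat L (φ ∧ ψ)   = Sat L φ × Sat L ψ
  Sat L (φ ∨ ψ)   = Sat L φ ⊎ Sat L ψ

  Dom : Set₁
  Dom = Σ (Formula → Set) (λ Φ → ∃ λ φ → Φ φ)

  SatSet : (Word → Set) → Dom → Set
  SatSet L Φ = ∀ φ → proj₁ Φ φ → Sat L φ

  -- Φ₁ ⇒ Φ₂ (the order of D_o; equality in D_o is mutual implication)
  _⇛_ : Dom → Dom → Set₁
  Φ₁ ⇛ Φ₂ = ∀ (L : Word → Set) → SatSet L Φ₁ → SatSet L Φ₂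

  mutual
    D : Kind → Set₁
    D o         = Dom
    D (κ₁ ⇒ κ₂) = Σ (D κ₁ → D κ₂) (Continuous κ₁ κ₂)

    Leq : (κ : Kind) → D κ → D κ → Set₁
    Leq o         Φ₁ Φ₂ = Φ₁ ⇛ Φ₂
    Leq (κ₁ ⇒ κ₂) f  g  = ∀ x → Leq κ₂ (proj₁ f x) (proj₁ g x)

    Descending : (κ : Kind) → (ℕ → D κ) → Set₁
    Descending κ c = ∀ i → Leq κ (c (suc i)) (c i)

    IsMeet : (κ : Kind) → (ℕ → D κ) → D κ → Set₁
    IsMeet κ c x = (∀ i → Leq κ x (c i))
                 × (∀ y → (∀ i → Leq κ y (c i)) → Leq κ y x)

    Continuous : (κ₁ κ₂ : Kind) → (D κ₁ → D κ₂) → Set₁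
    Continuous κ₁ κ₂ f = ∀ (c : ℕ → D κ₁) → Descending κ₁ c
                       → ∀ x → IsMeet κ₁ c x → IsMeet κ₂ (f ∘ c) (f x)

  -- raw (not yet known to be continuous) curried functions
  Raw : Kind → Set₁
  Raw o         = Dom
  Raw (κ₁ ⇒ κ₂) = Raw κ₁ → Raw κ₂

  Agree : (κ : Kind) → D κ → Raw κ → Set₁
  Agree o         x r = x ≡ r
  Agree (κ₁ ⇒ κ₂) f r = ∀ x y → Agree κ₁ x y → Agree κ₂ (proj₁ f x) (r y)

  single : Formula → Dom
  single φ = (λ ψ → ψ ≡ φ) , (φ , refl)

  prepend : Fin m → Formula → Formula
  prepend a true    = true
  prepend a ⟨ w ⟩   = ⟨ a ∷ w ⟩
  prepend a (φ ∧ ψ) = prepend a φ ∧ prepend a ψ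
  prepend a (φ ∨ ψ) = prepend a φ ∨ prepend a ψ

  prependSet : Fin m → Dom → Dom
  prependSet a (Φ , φ , φ∈) =
    (λ ψ → ∃ λ χ → Φ χ × ψ ≡ prepend a χ) , prepend a φ , φ , φ∈ , refl

  union : Dom → Dom → Dom
  union (Φ₁ , φ , φ∈) (Φ₂ , _) = (λ ψ → Φ₁ ψ ⊎ Φ₂ ψ) , φ , Data.Sum.inj₁ φ∈

  disj : Dom → Dom → Dom
  disj (Φ₁ , φ₁ , φ₁∈) (Φ₂ , φ₂ , φ₂∈) =
    (λ ψ → ∃ λ χ₁ → ∃ λ χ₂ → Φ₁ χ₁ × Φ₂ χ₂ × ψ ≡ (χ₁ ∨ χ₂)) ,
    (φ₁ ∨ φ₂) , φ₁ , φ₂ , φ₁∈ , φ₂∈ , refl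

  combine : Player → Dom → Dom → Dom
  combine ∀p = union
  combine ∃p = disj

  opAcc : Player → (k : ℕ) → Dom → Raw (foKind k)
  opAcc p zero    acc = acc
  opAcc p (suc k) acc = λ x → opAcc p k (combine p acc x)

  -- ℓ-ary conjunction (∀) / disjunction (∃), for ℓ ≥ 1 (non-ground kind)
  opSem : Player → (ℓ : ℕ) → foKind ℓ ≢ o → Raw (foKind ℓ)
  opSem p zero    ng = ⊥-elim (ng refl)
  opSem p (suc k) _  = λ x → opAcc p k x

module _ (g : Game) where
  open Concrete (Scheme.m (Game.G g))

  interp : (s : DetTerminal (Game.G g)) → kindT s ≢ o → Raw (kindT s)
  interp $          _  = single ⟨ [] ⟩
  interp (letter a) _  = prependSet a
  interp (op F)     ng = opSem (Game.O g F) (length (Scheme.rules (Game.G g) F)) ng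

module Submission where

-- The argument works entirely through satisfaction.  In D_o the meet x of
-- a chain c is satisfied by exactly the assignments satisfying every c i
-- (`meet-sat`).  Each unary building block f : D_o → D_o that occurs --
-- prepending a letter, and union / pairwise disjunction with a fixed set
-- on either side -- admits a *satisfaction reduction*: L satisfies f A iff
-- a side condition on L holds and A is satisfied by a family of
-- assignments derived from L alone.  Such an f is monotone and preserves
-- all meets of chains (`reduction-continuous`), and composing it before a
-- continuous map keeps continuity (`continuous-after-reduction`).
-- Disjunction reduces via the positivity fact that φ holds under
-- "L, or P everywhere" iff φ holds under L or P holds (`adjoin-sat`).
-- The terminal a is then a reduction directly; op_F is built by
-- induction on its arity, continuity in the newest argument coming from
-- the composition lemma and continuity in the earlier ones from
-- pointwise meets in function domains (`pointwise-meet`).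

open import Defs
open import Data.Product using (Σ)
open import Relation.Binary.PropositionalEquality using (_≢_)

open import Data.Nat using (ℕ; zero; suc)
open import Data.Fin using (Fin)
open import Data.List using (_∷_; length)
open import Data.Product using (_×_; _,_; proj₁; proj₂; ∃)
open import Data.Sum using (_⊎_; inj₁; inj₂; swap; map₁)
open import Data.Unit using (⊤; tt)
open import Data.Empty using (⊥-elim)
open import Relation.Binary.PropositionalEquality using (refl; cong)

module ConcreteContinuity (m : ℕ) where
  open Concrete m

  Assignment : Set₁
  Assignment = Word → Set

  derivative : Fin m → Assignment → Assignment
  derivative a L w = L (a ∷ w)

  prepend-sat⁻ : ∀ a L φ → Sat L (prepend a φ) → Sat (derivative a L) φ
  prepend-sat⁻ a L true      h        = tt
  prepend-sat⁻ a L ⟨ w ⟩     h        = h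
  prepend-sat⁻ a L (φ ∧ ψ)   (x , y)  = prepend-sat⁻ a L φ x , prepend-sat⁻ a L ψ y
  prepend-sat⁻ a L (φ ∨ ψ)   (inj₁ x) = inj₁ (prepend-sat⁻ a L φ x)
  prepend-sat⁻ a L (φ ∨ ψ)   (inj₂ y) = inj₂ (prepend-sat⁻ a L ψ y)

  prepend-sat⁺ : ∀ a L φ → Sat (derivative a L) φ → Sat L (prepend a φ)
  prepend-sat⁺ a L true      h        = tt
  prepend-sat⁺ a L ⟨ w ⟩     h        = h
  prepend-sat⁺ a L (φ ∧ ψ)   (x , y)  = prepend-sat⁺ a L φ x , prepend-sat⁺ a L ψ y
  prepend-sat⁺ a L (φ ∨ ψ)   (inj₁ x) = inj₁ (prepend-sat⁺ a L φ x)
  prepend-sat⁺ a L (φ ∨ ψ)   (inj₂ y) = inj₂ (prepend-sat⁺ a L ψ y)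

  _∪_ : Assignment → Set → Assignment
  (L ∪ P) w = L w ⊎ P

  -- For positive formulas, φ holds under L ∪ P iff φ holds under L or P
  -- holds; this turns "χ₁ ∨ χ₂ holds" into a satisfaction fact about χ₁.
  adjoin-sat⁺ : ∀ L P φ → Sat L φ ⊎ P → Sat (L ∪ P) φ
  adjoin-sat⁺ L P true    _               = tt
  adjoin-sat⁺ L P ⟨ w ⟩   h               = h
  adjoin-sat⁺ L P (φ ∧ ψ) (inj₁ (x , y))  = adjoin-sat⁺ L P φ (inj₁ x) , adjoin-sat⁺ L P ψ (inj₁ y)
  adjoin-sat⁺ L P (φ ∧ ψ) (inj₂ p)        = adjoin-sat⁺ L P φ (inj₂ p) , adjoin-sat⁺ L P ψ (inj₂ p)
  adjoin-sat⁺ L P (φ ∨ ψ) (inj₁ (inj₁ x)) = inj₁ (adjoin-sat⁺ L P φ (inj₁ x))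
  adjoin-sat⁺ L P (φ ∨ ψ) (inj₁ (inj₂ y)) = inj₂ (adjoin-sat⁺ L P ψ (inj₁ y))
  adjoin-sat⁺ L P (φ ∨ ψ) (inj₂ p)        = inj₁ (adjoin-sat⁺ L P φ (inj₂ p))

  adjoin-sat⁻ : ∀ L P φ → Sat (L ∪ P) φ → Sat L φ ⊎ P
  adjoin-sat⁻ L P true    _        = inj₁ tt
  adjoin-sat⁻ L P ⟨ w ⟩   h        = h
  adjoin-sat⁻ L P (φ ∧ ψ) (x , y) with adjoin-sat⁻ L P φ x | adjoin-sat⁻ L P ψ y
  ... | inj₁ x′ | inj₁ y′ = inj₁ (x′ , y′)
  ... | inj₂ p  | _       = inj₂ p
  ... | _       | inj₂ p  = inj₂ p
  adjoin-sat⁻ L P (φ ∨ ψ) (inj₁ x) = map₁ inj₁ (adjoin-sat⁻ L P φ x)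
  adjoin-sat⁻ L P (φ ∨ ψ) (inj₂ y) = map₁ inj₂ (adjoin-sat⁻ L P ψ y)

  chainUnion : (ℕ → Dom) → Dom
  chainUnion c = (λ φ → ∃ λ i → proj₁ (c i) φ) , proj₁ (proj₂ (c 0)) , 0 , proj₂ (proj₂ (c 0))

  -- An assignment satisfying every member of a chain satisfies its meet,
  -- since chainUnion c is a lower bound of c and hence implies the meet.
  meet-sat : ∀ c x → IsMeet o c x → ∀ L → (∀ i → SatSet L (c i)) → SatSet L x
  meet-sat c x (_ , greatest) L sat-c =
    greatest (chainUnion c) (λ i L′ sat φ φ∈ci → sat φ (i , φ∈ci)) L
             (λ { φ (i , φ∈ci) → sat-c i φ φ∈ci })

  record SatReduction (f : Dom → Dom) : Set₁ where
    field
      Side     : Assignment → Set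
      Index    : Assignment → Set
      shift    : (L : Assignment) → Index L → Assignment
      sound    : ∀ A L → SatSet L (f A) → Side L × (∀ j → SatSet (shift L j) A)
      complete : ∀ A L → Side L → (∀ j → SatSet (shift L j) A) → SatSet L (f A)

  module _ {f : Dom → Dom} (red : SatReduction f) where
    open SatReduction red

    reduction-monotone : ∀ A B → A ⇛ B → f A ⇛ f B
    reduction-monotone A B A⇛B L sat =
      complete B L (proj₁ (sound A L sat)) (λ j → A⇛B _ (proj₂ (sound A L sat) j))

    -- f x is the meet of f ∘ c: satisfying f x and satisfying every f (c i)
    -- both amount to the side condition plus every shift satisfying every c i.
    reduction-continuous : Continuous o o f
    reduction-continuous c _ x meet@(below , _) =
      (λ i L sat → complete (c i) L (proj₁ (sound x L sat))
                     (λ j → below i _ (proj₂ (sound x L sat) j))) ,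
      (λ y below-fc L sat-y →
         let sat-fc = λ i → sound (c i) L (below-fc i L sat-y) in
         complete x L (proj₁ (sat-fc 0))
           (λ j → meet-sat c x meet _ (λ i → proj₂ (sat-fc i) j)))

    -- Precomposing a continuous map with f keeps it continuous; monotonicity
    -- of f is what keeps the image chain descending.
    continuous-after-reduction : ∀ κ (g : Dom → D κ) → Continuous o κ g
                               → Continuous o κ (λ A → g (f A))
    continuous-after-reduction κ g g-cont c desc x meet =
      g-cont (λ i → f (c i)) (λ i → reduction-monotone _ _ (desc i))
             (f x) (reduction-continuous c desc x meet)

  prepend-reduction : ∀ a → SatReduction (prependSet a)
  prepend-reduction a = record
    { Side     = λ _ → ⊤
    ; Index    = λ _ → ⊤
    ; shift    = λ L _ → derivative a L
    ; sound    = λ A L sat → tt , λ _ χ χ∈A → prepend-sat⁻ a L χ (sat _ (χ , χ∈A , refl))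
    ; complete = λ { A L _ sat ψ (χ , χ∈A , refl) → prepend-sat⁺ a L χ (sat tt χ χ∈A) }
    }

  union-reductionˡ : ∀ B → SatReduction (λ A → union A B)
  union-reductionˡ B = record
    { Side     = λ L → SatSet L B
    ; Index    = λ _ → ⊤
    ; shift    = λ L _ → L
    ; sound    = λ A L sat → (λ φ φ∈B → sat φ (inj₂ φ∈B)) , λ _ φ φ∈A → sat φ (inj₁ φ∈A)
    ; complete = λ { A L sat-B sat-A φ (inj₁ φ∈A) → sat-A tt φ φ∈A
                   ; A L sat-B sat-A φ (inj₂ φ∈B) → sat-B φ φ∈B }
    }

  union-reductionʳ : ∀ A → SatReduction (λ B → union A B)
  union-reductionʳ A = record
    { Side     = λ L → SatSet L A
    ; Index    = λ _ → ⊤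
    ; shift    = λ L _ → L
    ; sound    = λ B L sat → (λ φ φ∈A → sat φ (inj₁ φ∈A)) , λ _ φ φ∈B → sat φ (inj₂ φ∈B)
    ; complete = λ { B L sat-A sat-B φ (inj₁ φ∈A) → sat-A φ φ∈A
                   ; B L sat-A sat-B φ (inj₂ φ∈B) → sat-B tt φ φ∈B }
    }

  -- L satisfies disj A B iff, for every χ₂ ∈ B, A is satisfied by
  -- L adjoined with "χ₂ holds under L".
  disj-reductionˡ : ∀ B → SatReduction (λ A → disj A B)
  disj-reductionˡ B = record
    { Side     = λ _ → ⊤
    ; Index    = λ _ → Σ Formula (proj₁ B)
    ; shift    = λ L (χ₂ , _) → L ∪ Sat L χ₂
    ; sound    = λ A L sat → tt , λ { (χ₂ , χ₂∈B) χ₁ χ₁∈A →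
                   adjoin-sat⁺ L _ χ₁ (sat _ (χ₁ , χ₂ , χ₁∈A , χ₂∈B , refl)) }
    ; complete = λ { A L _ sat ψ (χ₁ , χ₂ , χ₁∈A , χ₂∈B , refl) →
                   adjoin-sat⁻ L _ χ₁ (sat (χ₂ , χ₂∈B) χ₁ χ₁∈A) }
    }

  disj-reductionʳ : ∀ A → SatReduction (λ B → disj A B)
  disj-reductionʳ A = record
    { Side     = λ _ → ⊤
    ; Index    = λ _ → Σ Formula (proj₁ A)
    ; shift    = λ L (χ₁ , _) → L ∪ Sat L χ₁
    ; sound    = λ B L sat → tt , λ { (χ₁ , χ₁∈A) χ₂ χ₂∈B →
                   adjoin-sat⁺ L _ χ₂ (swap (sat _ (χ₁ , χ₂ , χ₁∈A , χ₂∈B , refl))) }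
    ; complete = λ { B L _ sat ψ (χ₁ , χ₂ , χ₁∈A , χ₂∈B , refl) →
                   swap (adjoin-sat⁻ L _ χ₂ (sat (χ₁ , χ₁∈A) χ₂ χ₂∈B)) }
    }

  combine-reductionˡ : ∀ p B → SatReduction (λ A → combine p A B)
  combine-reductionˡ ∀p B = union-reductionˡ B
  combine-reductionˡ ∃p B = disj-reductionˡ B

  combine-reductionʳ : ∀ p A → SatReduction (λ B → combine p A B)
  combine-reductionʳ ∀p A = union-reductionʳ A
  combine-reductionʳ ∃p A = disj-reductionʳ A

  pointwise-meet : ∀ κ₁ κ₂ (c : ℕ → D (κ₁ ⇒ κ₂)) (f : D (κ₁ ⇒ κ₂))
                 → (∀ y → IsMeet κ₂ (λ i → proj₁ (c i) y) (proj₁ f y))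
                 → IsMeet (κ₁ ⇒ κ₂) c f
  pointwise-meet κ₁ κ₂ c f meet-at =
    (λ i y → proj₁ (meet-at y) i) ,
    (λ g below y → proj₂ (meet-at y) (proj₁ g y) (λ i → below i y))

  mutual
    opDom : Player → (k : ℕ) → Dom → D (foKind k)
    opDom p zero    acc = acc
    opDom p (suc k) acc =
      (λ y → opDom p k (combine p acc y)) ,
      continuous-after-reduction (combine-reductionʳ p acc) (foKind k) (opDom p k) (opDom-continuous p k)

    opDom-continuous : ∀ p k → Continuous o (foKind k) (opDom p k)
    opDom-continuous p zero    c desc x meet = meet
    opDom-continuous p (suc k) c desc x meet =
      pointwise-meet o (foKind k) (λ i → opDom p (suc k) (c i)) (opDom p (suc k) x)
        (λ y → continuous-after-reduction (combine-reductionˡ p y) (foKind k) (opDom p k)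
                 (opDom-continuous p k) c desc x meet)

  opDom-agrees : ∀ p k acc → Agree (foKind k) (opDom p k acc) (opAcc p k acc)
  opDom-agrees p zero    acc          = refl
  opDom-agrees p (suc k) acc x .x refl = opDom-agrees p k (combine p acc x)

  letter-continuous : ∀ a → Σ (D (o ⇒ o)) (λ d → Agree (o ⇒ o) d (prependSet a))
  letter-continuous a =
    (prependSet a , reduction-continuous (prepend-reduction a)) , λ x y x≡y → cong (prependSet a) x≡y

  op-continuous : ∀ p ℓ (ng : foKind ℓ ≢ o)
                → Σ (D (foKind ℓ)) (λ d → Agree (foKind ℓ) d (opSem p ℓ ng))
  op-continuous p zero    ng = ⊥-elim (ng refl)
  op-continuous p (suc k) _  =
    (opDom p k , opDom-continuous p k) , λ { x .x refl → opDom-agrees p k x }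

lemma4p2 : (g : Game) (s : DetTerminal (Game.G g)) (ng : kindT s ≢ o)
         → Σ (Concrete.D (Scheme.m (Game.G g)) (kindT s))
             (λ d → Concrete.Agree (Scheme.m (Game.G g)) (kindT s) d
                      (interp g s ng))
lemma4p2 g $          ng = ⊥-elim (ng refl)
lemma4p2 g (letter a) _  = ConcreteContinuity.letter-continuous (Scheme.m (Game.G g)) a
lemma4p2 g (op F)     ng =
  ConcreteContinuity.op-continuous (Scheme.m (Game.G g)) (Game.O g F)
    (length (Scheme.rules (Game.G g) F)) ng
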